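{- Let $k\in\mathbb{Z}$ with $k\equiv \pm1 \pmod{4}$. Then $$\operatorname{Ker}\nu_{\theta^{2k}}=\left\{\begin{pmatrix} a&b\\ c&d\end{pmatrix}\in\Gamma(1)\;\Big|\;a\equiv d\equiv 1\pmod 4\text{ and } b\equiv c\equiv 0\pmod 2\right\}.$$ Moreover, $\pm I$ and $\pm T$, where $I=\begin{pmatrix} 1&0\\ 0&1\end{pmatrix}$ and $T=\begin{pmatrix} 0&-1\\ 1&0\end{pmatrix}$, form a complete set of coset representatives of $\Gamma_\theta$ modulo $\operatorname{Ker}\nu_{\theta^{2k}}$.
   Context: Let $\Gamma(1)=SL(2,\mathbb{Z})$ and $\Gamma_\theta=\{\begin{pmatrix} a&b\\ c&d\end{pmatrix}\in\Gamma(1): a\equiv d \bmod 2,\ b\equiv c\bmod 2\}$, acting on $\mathscr{H}=\{\tau\in\mathbb{C}:\Im\tau>0\}$ by $M\tau=\frac{a\tau+b}{c\tau+d}$. Let $\theta(\tau)=\sum_{n\in\mathbb{Z}}e^{\pi i n^2\tau}$. For $m\in\mathbb{Z}$, the multiplier system $\nu_{\theta^{2m}}:\Gamma_\theta\to\mathbb{C}^\times$ is defined by $\theta^{2m}(M\tau)=\nu_{\theta^{2m}}(M)(c\tau+d)^m\theta^{2m}(\tau)$ for all $\tau\in\mathscr{H}$, $M=\begin{pmatrix} a&b\\ c&d\end{pmatrix}\in\Gamma_\theta$; it is a character, given explicitly by $\nu_{\theta^{2m}}(M)=e^{ -m\pi i c/2}$ if $b\equiv c\equiv1$, $a\equiv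 d\equiv 0\pmod 2$, and $\nu_{\theta^{2m}}(M)=e^{m\pi i(d-1)/2}$ if $a\equiv d\equiv 1$, $b\equiv c\equiv 0\pmod 2$. $\operatorname{Ker}\nu_{\theta^{2m}}$ denotes its kernel. -}

module Defs where

open import Data.Nat using (ℕ; zero; suc)
open import Data.Integer using (ℤ; +_; -[1+_]; _+_; _-_; _*_; -_; _%ℕ_)
open import Data.Integer.Divisibility using (_∣_)
open import Data.Fin using (Fin)
open import Data.Product using (_×_)
open import Relation.Binary.PropositionalEquality using (_≡_)

record Mat : Set where
  constructor mat
  field
    a b c d : ℤ
open Mat public

_≡_[mod_] : ℤ → ℤ → ℤ → Set
x ≡ y [mod n ] = n ∣ (x - y)

IsSL2 : Mat → Set
IsSL2 M = a M * d M - b M * c M ≡ + 1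

InΓθ : Mat → Set
InΓθ M = IsSL2 M × (a M ≡ d M [mod + 2 ]) × (b M ≡ c M [mod + 2 ])

-- Matrix product and inverse (adjugate; the inverse on SL(2,ℤ)).
_·_ : Mat → Mat → Mat
M · N = mat (a M * a N + b M * c N) (a M * b N + b M * d N)
            (c M * a N + d M * c N) (c M * b N + d M * d N)

inv : Mat → Mat
inv M = mat (d M) (- b M) (- c M) (a M)

-- The multiplier ν_{θ^{2m}}(M) is a 4th root of unity; we record its
-- exponent e with ν_{θ^{2m}}(M) = i^e, following the explicit formula:
--   c odd  (b ≡ c ≡ 1, a ≡ d ≡ 0 mod 2):  ν = e^{-mπic/2} = i^{-mc}
--   c even (a ≡ d ≡ 1, b ≡ c ≡ 0 mod 2):  ν = e^{mπi(d-1)/2} = i^{m(d-1)}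
νExpAux : ℕ → ℤ → Mat → ℤ
νExpAux zero    m M = m * (d M - + 1)
νExpAux (suc _) m M = - (m * c M)

νExp : ℤ → Mat → ℤ
νExp m M = νExpAux (c M %ℕ 2) m M

-- Membership in Ker ν_{θ^{2m}} ⊆ Γ_θ : i^e = 1 iff 4 ∣ e.
InKer : ℤ → Mat → Set
InKer m M = InΓθ M × (+ 4 ∣ νExp m M)

I T : Mat
I = mat (+ 1) (+ 0) (+ 0) (+ 1)
T = mat (+ 0) (- + 1) (+ 1) (+ 0)

neg : Mat → Mat
neg M = mat (- a M) (- b M) (- c M) (- d M)

rep : Fin 4 → Mat
rep Fin.zero = I
rep (Fin.suc Fin.zero) = neg I
rep (Fin.suc (Fin.suc Fin.zero)) = T
rep (Fin.suc (Fin.suc (Fin.suc Fin.zero))) = neg T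

-- On Γθ the multiplier is i^(−kc) when c is odd and i^(k(d−1)) when c is even.
-- For odd k the first exponent is odd, so the kernel lies in the even-c part,
-- where k, a unit mod 4, cancels from 4 ∣ k(d−1) to give d ≡ 1 (mod 4), and
-- then ad ≡ 1 (mod 4) gives a ≡ 1.  Conversely an element of Γθ has, mod 4,
-- either b, c even and ad ≡ 1, or a, d even and c(−b) ≡ 1.  The units of ℤ/4
-- are ±1, so left multiplication by the inverse of ±I resp. ±T moves it into
-- the kernel; distinct representatives differ by −I or ±T, and neither of
-- these lies in the kernel.
module Submission where

open import Defs
open import Data.Integer using (ℤ; +_; -_)
open import Data.Fin using (Fin)
open import Data.Product using (_×_; ∃)
open import Data.Sum using (_⊎_)
open import Function.Bundles using (_⇔_)
open import Relation.Binary.PropositionalEquality using (_≡_)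

open import Data.Empty using (⊥-elim)
import Data.Fin as Fin
open import Data.Integer using (_+_; _-_; _*_; _%ℕ_; _/ℕ_; ∣_∣)
open import Data.Integer.DivMod using (a≡a%ℕn+[a/ℕn]*n; n%ℕd<d)
open import Data.Integer.Divisibility using (_∣_)
open import Data.Integer.Properties
  using (+-inverseʳ; +-identityʳ; *-identityˡ; *-zeroʳ; *-assoc; *-comm; neg-involutive; abs-*)
import Data.Integer.Divisibility.Signed as Signed
open import Data.Integer.Tactic.RingSolver using (solve-∀)
import Data.Nat as ℕ
import Data.Nat.Divisibility as ℕ
open import Data.Nat using (suc; s≤s)
open import Data.Product using (_,_; proj₁)
open import Data.Sum using (inj₁; inj₂)
import Data.Sum as Sum
open import Function.Bundles using (mk⇔)
open import Function.Construct.Composition using (_⇔-∘_)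
open import Level using (0ℓ)
open import Relation.Binary.Bundles using (Setoid)
open import Relation.Binary.PropositionalEquality using (refl; sym; trans; cong; cong₂; subst; subst₂)
open import Relation.Nullary using (Dec; ¬_)
open import Relation.Nullary.Decidable using (from-yes; from-no; map′)

private
  variable
    m n x y x′ y′ z : ℤ
    M : Mat

-- A record wrapper makes the three integers inferable from a proof, which
-- x ≡ y [mod n] (a divisibility between absolute values) does not allow.
infix 4 _≈_[mod_]
record _≈_[mod_] (x y n : ℤ) : Set where
  constructor wrap
  field unwrap : x ≡ y [mod n ]
open _≈_[mod_] public

private
  ≈-via : ∀ {e} → e ≡ x - y → Signed._∣_ n e → x ≈ y [mod n ]
  ≈-via refl n∣e = wrap (Signed.∣⇒∣ᵤ n∣e)

  signed : x ≈ y [mod n ] → Signed._∣_ n (x - y)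
  signed (wrap p) = Signed.∣ᵤ⇒∣ p

≈-reflexive : x ≡ y → x ≈ y [mod n ]
≈-reflexive {x} refl = ≈-via (sym (+-inverseʳ x)) (Signed.divides (+ 0) refl)

≈-refl : x ≈ x [mod n ]
≈-refl = ≈-reflexive refl

≈-sym : x ≈ y [mod n ] → y ≈ x [mod n ]
≈-sym {x} {y} p = ≈-via (lemma x y) (Signed.∣m⇒∣-m (signed p))
  where
  lemma : ∀ x y → - (x - y) ≡ y - x
  lemma = solve-∀

≈-trans : x ≈ y [mod n ] → y ≈ z [mod n ] → x ≈ z [mod n ]
≈-trans {x} {y} {z = z} p q = ≈-via (lemma x y z) (Signed.∣m∣n⇒∣m+n (signed p) (signed q))
  where
  lemma : ∀ x y z → (x - y) + (y - z) ≡ x - z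
  lemma = solve-∀

≈-setoid : ℤ → Setoid 0ℓ 0ℓ
≈-setoid n = record
  { Carrier = ℤ
  ; _≈_ = _≈_[mod n ]
  ; isEquivalence = record { refl = ≈-refl ; sym = ≈-sym ; trans = ≈-trans }
  }

module ≈-Reasoning (n : ℤ) where
  open import Relation.Binary.Reasoning.Setoid (≈-setoid n) public

≈-+ : x ≈ x′ [mod n ] → y ≈ y′ [mod n ] → x + y ≈ x′ + y′ [mod n ]
≈-+ {x} {x′} {y = y} {y′} p q = ≈-via (lemma x x′ y y′) (Signed.∣m∣n⇒∣m+n (signed p) (signed q))
  where
  lemma : ∀ x x′ y y′ → (x - x′) + (y - y′) ≡ (x + y) - (x′ + y′)
  lemma = solve-∀

≈-* : x ≈ x′ [mod n ] → y ≈ y′ [mod n ] → x * y ≈ x′ * y′ [mod n ]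
≈-* {x} {x′} {y = y} {y′} p q = ≈-via (lemma x x′ y y′)
  (Signed.∣m∣n⇒∣m+n (Signed.∣m⇒∣m*n y (signed p)) (Signed.∣n⇒∣m*n x′ (signed q)))
  where
  lemma : ∀ x x′ y y′ → (x - x′) * y + x′ * (y - y′) ≡ x * y - x′ * y′
  lemma = solve-∀

≈-neg : x ≈ y [mod n ] → - x ≈ - y [mod n ]
≈-neg {x} {y} p = ≈-via (lemma x y) (Signed.∣m⇒∣-m (signed p))
  where
  lemma : ∀ x y → - (x - y) ≡ - x - - y
  lemma = solve-∀

≈-- : x ≈ x′ [mod n ] → y ≈ y′ [mod n ] → x - y ≈ x′ - y′ [mod n ]
≈-- p q = ≈-+ p (≈-neg q)

≈[mod4]⇒≈[mod2] : x ≈ y [mod + 4 ] → x ≈ y [mod + 2 ]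
≈[mod4]⇒≈[mod2] (wrap p) = wrap (ℕ.∣-trans (ℕ.divides 2 refl) p)

∣⇒≈0 : n ∣ x → x ≈ + 0 [mod n ]
∣⇒≈0 {n} {x} n∣x = wrap (subst (n ∣_) (sym (+-identityʳ x)) n∣x)

≈0⇒∣ : x ≈ + 0 [mod n ] → n ∣ x
≈0⇒∣ {x} {n} (wrap p) = subst (n ∣_) (+-identityʳ x) p

≈0-* : x ≈ + 0 [mod m ] → y ≈ + 0 [mod n ] → x * y ≈ + 0 [mod m * n ]
≈0-* {x} {m} {y} {n} p q = ∣⇒≈0
  (subst₂ ℕ._∣_ (sym (abs-* m n)) (sym (abs-* x y)) (ℕ.*-pres-∣ (≈0⇒∣ p) (≈0⇒∣ q)))

infix 4 _≈?_[mod_]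
_≈?_[mod_] : (x y n : ℤ) → Dec (x ≈ y [mod n ])
x ≈? y [mod n ] = map′ wrap unwrap (∣ n ∣ ℕ.∣? ∣ x - y ∣)

≈%ℕ : ∀ x n .{{_ : ℕ.NonZero n}} → x ≈ + (x %ℕ n) [mod + n ]
≈%ℕ x n = ≈-via (sym (trans (cong (_- r) (a≡a%ℕn+[a/ℕn]*n x n)) (lemma r (x /ℕ n) (+ n))))
  (Signed.divides (x /ℕ n) refl)
  where
  r : ℤ
  r = + (x %ℕ n)
  lemma : ∀ r q n → (r + q * n) - r ≡ q * n
  lemma = solve-∀

1≉0[mod2] : ¬ (+ 1 ≈ + 0 [mod + 2 ])
1≉0[mod2] = from-no (+ 1 ≈? + 0 [mod + 2 ])

-1≉1[mod4] : ¬ (- + 1 ≈ + 1 [mod + 4 ])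
-1≉1[mod4] = from-no (- + 1 ≈? + 1 [mod + 4 ])

-1≉0[mod2] : ¬ (- + 1 ≈ + 0 [mod + 2 ])
-1≉0[mod2] = from-no (- + 1 ≈? + 0 [mod + 2 ])

even-or-odd : ∀ x → x ≈ + 0 [mod + 2 ] ⊎ x ≈ + 1 [mod + 2 ]
even-or-odd x with x %ℕ 2 | n%ℕd<d x 2 | ≈%ℕ x 2
... | 0           | _            | x≈0 = inj₁ x≈0
... | 1           | _            | x≈1 = inj₂ x≈1
... | suc (suc _) | s≤s (s≤s ()) | _

even⇒%ℕ2≡0 : x ≈ + 0 [mod + 2 ] → x %ℕ 2 ≡ 0
even⇒%ℕ2≡0 {x} x≈0 with x %ℕ 2 | n%ℕd<d x 2 | ≈%ℕ x 2
... | 0           | _            | _   = refl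
... | 1           | _            | x≈1 = ⊥-elim (1≉0[mod2] (≈-trans (≈-sym x≈1) x≈0))
... | suc (suc _) | s≤s (s≤s ()) | _

odd⇒%ℕ2≡1 : x ≈ + 1 [mod + 2 ] → x %ℕ 2 ≡ 1
odd⇒%ℕ2≡1 {x} x≈1 with x %ℕ 2 | n%ℕd<d x 2 | ≈%ℕ x 2
... | 0           | _            | x≈0 = ⊥-elim (1≉0[mod2] (≈-trans (≈-sym x≈1) x≈0))
... | 1           | _            | _   = refl
... | suc (suc _) | s≤s (s≤s ()) | _

unit[mod4]⇒≈±1 : x * y ≈ + 1 [mod + 4 ] → x ≈ + 1 [mod + 4 ] ⊎ x ≈ - + 1 [mod + 4 ]
unit[mod4]⇒≈±1 {x} {y} xy≈1 with x %ℕ 4 | n%ℕd<d x 4 | ≈%ℕ x 4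
... | 0 | _ | x≈0 = ⊥-elim (from-no (+ 1 ≈? + 0 [mod + 4 ]) (begin
  + 1      ≈⟨ ≈-sym xy≈1 ⟩
  x * y    ≈⟨ ≈-* x≈0 ≈-refl ⟩
  + 0 * y  ≡⟨⟩
  + 0      ∎))
  where open ≈-Reasoning (+ 4)
... | 1 | _ | x≈1 = inj₁ x≈1
... | 2 | _ | x≈2 = ⊥-elim (1≉0[mod2] (begin
  + 1      ≈⟨ ≈[mod4]⇒≈[mod2] (≈-sym xy≈1) ⟩
  x * y    ≈⟨ ≈[mod4]⇒≈[mod2] (≈-* x≈2 ≈-refl) ⟩
  + 2 * y  ≈⟨ ∣⇒≈0 (Signed.∣⇒∣ᵤ (Signed.∣m⇒∣m*n y (Signed.∣-refl {+ 2}))) ⟩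
  + 0      ∎))
  where open ≈-Reasoning (+ 2)
... | 3 | _ | x≈3 = inj₂ (≈-trans x≈3 (from-yes (+ 3 ≈? - + 1 [mod + 4 ])))
... | suc (suc (suc (suc _))) | s≤s (s≤s (s≤s (s≤s ()))) | _

≈±1⇒square≈1 : x ≈ + 1 [mod n ] ⊎ x ≈ - + 1 [mod n ] → x * x ≈ + 1 [mod n ]
≈±1⇒square≈1 (inj₁ x≈1)  = ≈-* x≈1 x≈1
≈±1⇒square≈1 (inj₂ x≈-1) = ≈-* x≈-1 x≈-1

≈±1[mod4]⇒odd : x ≈ + 1 [mod + 4 ] ⊎ x ≈ - + 1 [mod + 4 ] → x ≈ + 1 [mod + 2 ]
≈±1[mod4]⇒odd (inj₁ x≈1)  = ≈[mod4]⇒≈[mod2] x≈1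
≈±1[mod4]⇒odd (inj₂ x≈-1) = ≈-trans (≈[mod4]⇒≈[mod2] x≈-1) (from-yes (- + 1 ≈? + 1 [mod + 2 ]))

unit-cancel : ∀ x → x * x ≈ + 1 [mod n ] → x * y ≈ + 0 [mod n ] → y ≈ + 0 [mod n ]
unit-cancel {n} {y} x xx≈1 xy≈0 = begin
  y            ≡⟨ sym (*-identityˡ y) ⟩
  + 1 * y      ≈⟨ ≈-* (≈-sym xx≈1) ≈-refl ⟩
  x * x * y    ≡⟨ *-assoc x x y ⟩
  x * (x * y)  ≈⟨ ≈-* (≈-refl {x}) xy≈0 ⟩
  x * + 0      ≡⟨ *-zeroʳ x ⟩
  + 0          ∎
  where open ≈-Reasoning n

unit-inverse : x ≈ + 1 [mod n ] → x * y ≈ + 1 [mod n ] → y ≈ + 1 [mod n ]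
unit-inverse {x} {n} {y} x≈1 xy≈1 = begin
  y        ≡⟨ sym (*-identityˡ y) ⟩
  + 1 * y  ≈⟨ ≈-* (≈-sym x≈1) ≈-refl ⟩
  x * y    ≈⟨ xy≈1 ⟩
  + 1      ∎
  where open ≈-Reasoning n

νExp-even : c M ≈ + 0 [mod + 2 ] → νExp m M ≡ m * (d M - + 1)
νExp-even {M} {m} c≈0 = cong (λ r → νExpAux r m M) (even⇒%ℕ2≡0 c≈0)

νExp-odd : c M ≈ + 1 [mod + 2 ] → νExp m M ≡ - (m * c M)
νExp-odd {M} {m} c≈1 = cong (λ r → νExpAux r m M) (odd⇒%ℕ2≡1 c≈1)

record KerCongruence (M : Mat) : Set where
  constructor kerCongruence
  field
    a≈1 : a M ≈ + 1 [mod + 4 ]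
    d≈1 : d M ≈ + 1 [mod + 4 ]
    b≈0 : b M ≈ + 0 [mod + 2 ]
    c≈0 : c M ≈ + 0 [mod + 2 ]

KerCongruence⇔ : ∀ M → KerCongruence M ⇔
  ((a M ≡ + 1 [mod + 4 ]) × (d M ≡ + 1 [mod + 4 ]) × (b M ≡ + 0 [mod + 2 ]) × (c M ≡ + 0 [mod + 2 ]))
KerCongruence⇔ M = mk⇔
  (λ (kerCongruence (wrap p) (wrap q) (wrap r) (wrap s)) → p , q , r , s)
  (λ (p , q , r , s) → kerCongruence (wrap p) (wrap q) (wrap r) (wrap s))

IsSL2⇒ad≈1 : IsSL2 M → b M ≈ + 0 [mod + 2 ] → c M ≈ + 0 [mod + 2 ] → a M * d M ≈ + 1 [mod + 4 ]
IsSL2⇒ad≈1 {M} det b≈0 c≈0 = begin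
  a M * d M                          ≡⟨ lemma (a M * d M) (b M * c M) ⟩
  (a M * d M - b M * c M) + b M * c M  ≈⟨ ≈-+ (≈-reflexive det) (≈0-* b≈0 c≈0) ⟩
  + 1                                ∎
  where
  open ≈-Reasoning (+ 4)
  lemma : ∀ x y → x ≡ (x - y) + y
  lemma = solve-∀

IsSL2⇒c*-b≈1 : IsSL2 M → a M ≈ + 0 [mod + 2 ] → d M ≈ + 0 [mod + 2 ] → c M * - b M ≈ + 1 [mod + 4 ]
IsSL2⇒c*-b≈1 {M} det a≈0 d≈0 = begin
  c M * - b M                          ≡⟨ lemma (a M * d M) (b M) (c M) ⟩
  (a M * d M - b M * c M) - a M * d M  ≈⟨ ≈-- (≈-reflexive det) (≈0-* a≈0 d≈0) ⟩
  + 1                                  ∎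
  where
  open ≈-Reasoning (+ 4)
  lemma : ∀ x y z → z * - y ≡ (x - y * z) - x
  lemma = solve-∀

InΓθ∧odd-c⇒even-a : InΓθ M → c M ≈ + 1 [mod + 2 ] → a M ≈ + 0 [mod + 2 ]
InΓθ∧odd-c⇒even-a {M} (det , a≡d , b≡c) c≈1 with even-or-odd (a M)
... | inj₁ a≈0 = a≈0
... | inj₂ a≈1 = ⊥-elim (1≉0[mod2] (begin
  + 1                    ≡⟨ sym det ⟩
  a M * d M - b M * c M  ≈⟨ ≈-- (≈-* a≈1 (≈-trans (≈-sym a≈d) a≈1)) (≈-* (≈-trans b≈c c≈1) c≈1) ⟩
  + 0                    ∎))
  where
  open ≈-Reasoning (+ 2)
  a≈d : a M ≈ d M [mod + 2 ]
  a≈d = wrap a≡d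
  b≈c : b M ≈ c M [mod + 2 ]
  b≈c = wrap b≡c

InKer⇒KerCongruence : m ≈ + 1 [mod + 4 ] ⊎ m ≈ - + 1 [mod + 4 ] → InKer m M → KerCongruence M
InKer⇒KerCongruence {m} {M} m≈±1 ((det , _ , b≡c) , 4∣ν) with even-or-odd (c M)
... | inj₂ c≈1 = ⊥-elim (1≉0[mod2] (begin
  + 1 * + 1      ≈⟨ ≈-sym (≈-* (≈±1[mod4]⇒odd m≈±1) c≈1) ⟩
  m * c M        ≡⟨ sym (neg-involutive (m * c M)) ⟩
  - (- (m * c M)) ≈⟨ ≈[mod4]⇒≈[mod2] (≈-neg -mc≈0) ⟩
  + 0            ∎))
  where
  open ≈-Reasoning (+ 2)
  -mc≈0 : - (m * c M) ≈ + 0 [mod + 4 ]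
  -mc≈0 = ∣⇒≈0 (subst (+ 4 ∣_) (νExp-odd c≈1) 4∣ν)
... | inj₁ c≈0 = kerCongruence a≈1 d≈1 b≈0 c≈0
  where
  b≈c : b M ≈ c M [mod + 2 ]
  b≈c = wrap b≡c
  b≈0 : b M ≈ + 0 [mod + 2 ]
  b≈0 = ≈-trans b≈c c≈0
  d-1≈0 : d M - + 1 ≈ + 0 [mod + 4 ]
  d-1≈0 = unit-cancel m (≈±1⇒square≈1 m≈±1) (∣⇒≈0 (subst (+ 4 ∣_) (νExp-even c≈0) 4∣ν))
  d≈1 : d M ≈ + 1 [mod + 4 ]
  d≈1 = wrap (≈0⇒∣ d-1≈0)
  a≈1 : a M ≈ + 1 [mod + 4 ]
  a≈1 = unit-inverse d≈1 (≈-trans (≈-reflexive (*-comm (d M) (a M))) (IsSL2⇒ad≈1 {M} det b≈0 c≈0))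

KerCongruence⇒InKer : IsSL2 M → KerCongruence M → InKer m M
KerCongruence⇒InKer {M} {m} det (kerCongruence a≈1 d≈1 b≈0 c≈0) =
  (det , unwrap (≈[mod4]⇒≈[mod2] (≈-trans a≈1 (≈-sym d≈1))) , unwrap (≈-trans b≈0 (≈-sym c≈0))) ,
  subst (+ 4 ∣_) (sym (νExp-even {M} {m} c≈0)) (Signed.∣⇒∣ᵤ (Signed.∣n⇒∣m*n m (signed d≈1)))

mat-cong : ∀ {p q r s p′ q′ r′ s′} → p ≡ p′ → q ≡ q′ → r ≡ r′ → s ≡ s′ → mat p q r s ≡ mat p′ q′ r′ s′
mat-cong refl refl refl refl = refl

IsSL2-· : ∀ M N → IsSL2 M → IsSL2 N → IsSL2 (M · N)
IsSL2-· (mat p q r s) (mat p′ q′ r′ s′) detM detN =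
  trans (det-multiplicative p q r s p′ q′ r′ s′) (cong₂ _*_ detM detN)
  where
  det-multiplicative : ∀ p q r s p′ q′ r′ s′ →
    (p * p′ + q * r′) * (r * q′ + s * s′) - (p * q′ + q * s′) * (r * p′ + s * r′)
      ≡ (p * s - q * r) * (p′ * s′ - q′ * r′)
  det-multiplicative = solve-∀

IsSL2-inv : ∀ M → IsSL2 M → IsSL2 (inv M)
IsSL2-inv (mat p q r s) det = trans (lemma p q r s) det
  where
  lemma : ∀ p q r s → s * p - (- q) * (- r) ≡ p * s - q * r
  lemma = solve-∀

private
  +1*x+0*y≡x : ∀ x y → + 1 * x + + 0 * y ≡ x
  +1*x+0*y≡x = solve-∀
  +0*x+1*y≡y : ∀ x y → + 0 * x + + 1 * y ≡ y
  +0*x+1*y≡y = solve-∀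
  -1*x+0*y≡-x : ∀ x y → - + 1 * x + + 0 * y ≡ - x
  -1*x+0*y≡-x = solve-∀
  +0*x-1*y≡-y : ∀ x y → + 0 * x + - + 1 * y ≡ - y
  +0*x-1*y≡-y = solve-∀

I⁻¹· : ∀ M → inv I · M ≡ M
I⁻¹· (mat p q r s) = mat-cong (+1*x+0*y≡x p r) (+1*x+0*y≡x q s) (+0*x+1*y≡y p r) (+0*x+1*y≡y q s)

[-I]⁻¹· : ∀ M → inv (neg I) · M ≡ neg M
[-I]⁻¹· (mat p q r s) = mat-cong (-1*x+0*y≡-x p r) (-1*x+0*y≡-x q s) (+0*x-1*y≡-y p r) (+0*x-1*y≡-y q s)

T⁻¹· : ∀ M → inv T · M ≡ mat (c M) (d M) (- a M) (- b M)
T⁻¹· (mat p q r s) = mat-cong (+0*x+1*y≡y p r) (+0*x+1*y≡y q s) (-1*x+0*y≡-x p r) (-1*x+0*y≡-x q s)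

[-T]⁻¹· : ∀ M → inv (neg T) · M ≡ mat (- c M) (- d M) (a M) (b M)
[-T]⁻¹· (mat p q r s) = mat-cong (+0*x-1*y≡-y p r) (+0*x-1*y≡-y q s) (+1*x+0*y≡x p r) (+1*x+0*y≡x q s)

pattern ⟨I⟩  = Fin.zero
pattern ⟨-I⟩ = Fin.suc Fin.zero
pattern ⟨T⟩  = Fin.suc (Fin.suc Fin.zero)
pattern ⟨-T⟩ = Fin.suc (Fin.suc (Fin.suc Fin.zero))

coset-of-even-c : a M * d M ≈ + 1 [mod + 4 ] → b M ≈ + 0 [mod + 2 ] → c M ≈ + 0 [mod + 2 ] →
                  ∃ λ i → KerCongruence (inv (rep i) · M)
coset-of-even-c {M} ad≈1 b≈0 c≈0 with unit[mod4]⇒≈±1 ad≈1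
... | inj₁ a≈1 = ⟨I⟩ , subst KerCongruence (sym (I⁻¹· M))
  (kerCongruence a≈1 (unit-inverse a≈1 ad≈1) b≈0 c≈0)
... | inj₂ a≈-1 = ⟨-I⟩ , subst KerCongruence (sym ([-I]⁻¹· M))
  (kerCongruence -a≈1 (unit-inverse -a≈1 (≈-trans (≈-reflexive (neg*neg (a M) (d M))) ad≈1))
                 (≈-neg b≈0) (≈-neg c≈0))
  where
  -a≈1 : - a M ≈ + 1 [mod + 4 ]
  -a≈1 = ≈-neg a≈-1
  neg*neg : ∀ x y → - x * - y ≡ x * y
  neg*neg = solve-∀

coset-of-odd-c : c M * - b M ≈ + 1 [mod + 4 ] → a M ≈ + 0 [mod + 2 ] → d M ≈ + 0 [mod + 2 ] →
                 ∃ λ i → KerCongruence (inv (rep i) · M)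
coset-of-odd-c {M} -cb≈1 a≈0 d≈0 with unit[mod4]⇒≈±1 -cb≈1
... | inj₁ c≈1 = ⟨T⟩ , subst KerCongruence (sym (T⁻¹· M))
  (kerCongruence c≈1 (unit-inverse c≈1 -cb≈1) d≈0 (≈-neg a≈0))
... | inj₂ c≈-1 = ⟨-T⟩ , subst KerCongruence (sym ([-T]⁻¹· M))
  (kerCongruence -c≈1 (unit-inverse -c≈1 (≈-trans (≈-reflexive (neg*x (c M) (b M))) -cb≈1))
                 (≈-neg d≈0) a≈0)
  where
  -c≈1 : - c M ≈ + 1 [mod + 4 ]
  -c≈1 = ≈-neg c≈-1
  neg*x : ∀ x y → - x * y ≡ x * - y
  neg*x = solve-∀

Γθ-coset : ∀ M → InΓθ M → ∃ λ i → KerCongruence (inv (rep i) · M)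
Γθ-coset M γ@(det , a≡d , b≡c) with even-or-odd (c M)
... | inj₁ c≈0 = coset-of-even-c (IsSL2⇒ad≈1 {M} det b≈0 c≈0) b≈0 c≈0
  where
  b≈c : b M ≈ c M [mod + 2 ]
  b≈c = wrap b≡c
  b≈0 : b M ≈ + 0 [mod + 2 ]
  b≈0 = ≈-trans b≈c c≈0
... | inj₂ c≈1 = coset-of-odd-c (IsSL2⇒c*-b≈1 {M} det a≈0 d≈0) a≈0 d≈0
  where
  a≈d : a M ≈ d M [mod + 2 ]
  a≈d = wrap a≡d
  a≈0 : a M ≈ + 0 [mod + 2 ]
  a≈0 = InΓθ∧odd-c⇒even-a {M} γ c≈1
  d≈0 : d M ≈ + 0 [mod + 2 ]
  d≈0 = ≈-trans (≈-sym a≈d) a≈0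

rep-InΓθ : ∀ i → InΓθ (rep i)
rep-InΓθ ⟨I⟩  = refl , ℕ.divides 0 refl , ℕ.divides 0 refl
rep-InΓθ ⟨-I⟩ = refl , ℕ.divides 0 refl , ℕ.divides 0 refl
rep-InΓθ ⟨T⟩  = refl , ℕ.divides 0 refl , ℕ.divides 1 refl
rep-InΓθ ⟨-T⟩ = refl , ℕ.divides 0 refl , ℕ.divides 1 refl

IsSL2-rep⁻¹· : ∀ i M → IsSL2 M → IsSL2 (inv (rep i) · M)
IsSL2-rep⁻¹· i M = IsSL2-· (inv (rep i)) M (IsSL2-inv (rep i) (proj₁ (rep-InΓθ i)))

-- inv (rep i) · rep j is ±I or ±T: −I has a ≢ 1 (mod 4), and ±T have odd c.
rep-separated : ∀ i j → KerCongruence (inv (rep i) · rep j) → i ≡ j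
rep-separated ⟨I⟩  ⟨I⟩  _ = refl
rep-separated ⟨-I⟩ ⟨-I⟩ _ = refl
rep-separated ⟨T⟩  ⟨T⟩  _ = refl
rep-separated ⟨-T⟩ ⟨-T⟩ _ = refl
rep-separated ⟨I⟩  ⟨-I⟩ κ = ⊥-elim (-1≉1[mod4] (KerCongruence.a≈1 κ))
rep-separated ⟨-I⟩ ⟨I⟩  κ = ⊥-elim (-1≉1[mod4] (KerCongruence.a≈1 κ))
rep-separated ⟨T⟩  ⟨-T⟩ κ = ⊥-elim (-1≉1[mod4] (KerCongruence.a≈1 κ))
rep-separated ⟨-T⟩ ⟨T⟩  κ = ⊥-elim (-1≉1[mod4] (KerCongruence.a≈1 κ))
rep-separated ⟨I⟩  ⟨T⟩  κ = ⊥-elim (1≉0[mod2] (KerCongruence.c≈0 κ))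
rep-separated ⟨-I⟩ ⟨-T⟩ κ = ⊥-elim (1≉0[mod2] (KerCongruence.c≈0 κ))
rep-separated ⟨T⟩  ⟨-I⟩ κ = ⊥-elim (1≉0[mod2] (KerCongruence.c≈0 κ))
rep-separated ⟨-T⟩ ⟨I⟩  κ = ⊥-elim (1≉0[mod2] (KerCongruence.c≈0 κ))
rep-separated ⟨I⟩  ⟨-T⟩ κ = ⊥-elim (-1≉0[mod2] (KerCongruence.c≈0 κ))
rep-separated ⟨-I⟩ ⟨T⟩  κ = ⊥-elim (-1≉0[mod2] (KerCongruence.c≈0 κ))
rep-separated ⟨T⟩  ⟨I⟩  κ = ⊥-elim (-1≉0[mod2] (KerCongruence.c≈0 κ))
rep-separated ⟨-T⟩ ⟨-I⟩ κ = ⊥-elim (-1≉0[mod2] (KerCongruence.c≈0 κ))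

mainTheorem10 : (k : ℤ) → (k ≡ + 1 [mod + 4 ] ⊎ k ≡ - + 1 [mod + 4 ]) →
    ((M : Mat) → IsSL2 M →
      (InKer k M ⇔ ((a M ≡ + 1 [mod + 4 ]) × (d M ≡ + 1 [mod + 4 ])
                    × (b M ≡ + 0 [mod + 2 ]) × (c M ≡ + 0 [mod + 2 ]))))
    × ((i : Fin 4) → InΓθ (rep i))
    × ((M : Mat) → InΓθ M → ∃ λ (i : Fin 4) → InKer k (inv (rep i) · M))
    × ((i j : Fin 4) → InKer k (inv (rep i) · rep j) → i ≡ j)
mainTheorem10 k k≡±1 =
  (λ M det → KerCongruence⇔ M ⇔-∘ mk⇔ (InKer⇒KerCongruence k≈±1) (KerCongruence⇒InKer det)) ,
  rep-InΓθ ,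
  (λ M γ → let i , κ = Γθ-coset M γ in i , KerCongruence⇒InKer (IsSL2-rep⁻¹· i M (proj₁ γ)) κ) ,
  (λ i j κ → rep-separated i j (InKer⇒KerCongruence k≈±1 κ))
  where
  k≈±1 : k ≈ + 1 [mod + 4 ] ⊎ k ≈ - + 1 [mod + 4 ]
  k≈±1 = Sum.map wrap wrap k≡±1
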